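{- An LTLf specification is realizable iff it admits a bounded winning strategy, i.e. a strategy for which there exists $B > 0$ such that every induced finite trace has length at most $B$. There exist realizable constrained LTLf specifications that do not possess any bounded winning strategy.
   Context: Let $\mathcal{X}$ (uncontrollable) and $\mathcal{Y}$ (controllable) be disjoint finite sets of propositional variables. An LTLf specification $\langle \mathcal{X}, \mathcal{Y}, \varphi \rangle$ has $\varphi$ an LTL formula interpreted over finite traces. A strategy for it is a function $\sigma: (2^{\mathcal{X}})^* \rightarrow 2^{\mathcal{Y} \cup \{\mathsf{end}\}}$ such that for every infinite sequence $\mathbf{X}=X_1X_2\ldots$ of subsets of $\mathcal{X}$ there is exactly one $n\geq1$ with $\mathsf{end}\in\sigma(X_1\cdots X_n)$; the induced finite trace is $(X_1\cup\sigma(X_1))\cdots(X_n\cup\sigma(X_1\cdots X_n))$ with $\mathsf{end}$ removed, and $\sigma$ is winning if all induced finite traces satisfy $\varphi$. A constrained LTLf specification $\langle \mathcal{X}, \mathcal{Y}, \alpha, \varphi \rangle$ adds an LTL assumption $\alpha$ interpreted over infinite traces; strategies output $\mathsf{end}$ at most once per $\mathbf{X}$; a strategy is an $\alpha$-strategy if for every $\mathbf{X}$ either $\mathsf{end}$ is output at some finite step or the induced infinite trace $(X_1\cup\sigma(X_1))(X_2\cup\sigma(X_1X_2))\cdots$ violates $\alpha$; it is winning if it is an $\alpha$-strategy and every induced finite trace satisfies $\varphi$. Realizability means a winning strategy exists. -}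

module Defs where

open import Data.Nat using (ℕ; zero; suc; _≤_; _<_)
open import Data.Fin using (Fin)
open import Data.Bool using (Bool; true)
open import Data.List using (List; map; upTo)
open import Data.Sum using (_⊎_; [_,_])
open import Data.Product using (_×_; ∃; ∃-syntax; Σ; proj₁; proj₂)
open import Data.Unit using (⊤)
open import Relation.Nullary using (¬_)
open import Relation.Binary.PropositionalEquality using (_≡_)

-- Propositional variables: 𝒳 = Fin nX (uncontrollable), 𝒴 = Fin nY
-- (controllable); the disjoint union Fin nX ⊎ Fin nY keeps them disjoint.
Var : ℕ → ℕ → Set
Var nX nY = Fin nX ⊎ Fin nY

data Formula (nX nY : ℕ) : Set where
  tt   : Formula nX nY
  atom : Var nX nY → Formula nX nY
  ¬'_  : Formula nX nY → Formula nX nY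
  _∧'_ : Formula nX nY → Formula nX nY → Formula nX nY
  ◯_   : Formula nX nY → Formula nX nY
  _U_  : Formula nX nY → Formula nX nY → Formula nX nY

Letter : ℕ → ℕ → Set
Letter nX nY = Var nX nY → Bool

Trace : ℕ → ℕ → Set
Trace nX nY = ℕ → Letter nX nY

-- LTLf semantics: trace w of length len (only positions < len matter),
-- satisfaction at position i (< len).  Next is strong next.
SatF : ∀ {nX nY} → ℕ → Trace nX nY → ℕ → Formula nX nY → Set
SatF len w i tt        = ⊤
SatF len w i (atom p)  = w i p ≡ true
SatF len w i (¬' φ)    = ¬ SatF len w i φ
SatF len w i (φ ∧' ψ)  = SatF len w i φ × SatF len w i ψ
SatF len w i (◯ φ)     = suc i < len × SatF len w (suc i) φ
SatF len w i (φ U ψ)   = ∃[ j ] (i ≤ j × j < len × SatF len w j ψ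
                           × (∀ k → i ≤ k → k < j → SatF len w k φ))

SatI : ∀ {nX nY} → Trace nX nY → ℕ → Formula nX nY → Set
SatI w i tt        = ⊤
SatI w i (atom p)  = w i p ≡ true
SatI w i (¬' φ)    = ¬ SatI w i φ
SatI w i (φ ∧' ψ)  = SatI w i φ × SatI w i ψ
SatI w i (◯ φ)     = SatI w (suc i) φ
SatI w i (φ U ψ)   = ∃[ j ] (i ≤ j × SatI w j ψ
                           × (∀ k → i ≤ k → k < j → SatI w k φ))

-- Strategies σ : (2^𝒳)* → 2^{𝒴 ∪ {end}}, represented as a pair
-- (controllable assignment, end flag).  Only nonempty histories matter.
Strategy : ℕ → ℕ → Set
Strategy nX nY = List (Fin nX → Bool) → (Fin nY → Bool) × Bool

-- Infinite input sequence X = X₁ X₂ …, with X₁ at index 0.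
Input : ℕ → Set
Input nX = ℕ → Fin nX → Bool

-- The history X₁ ⋯ X_{i+1}.
prefix : ∀ {nX} → Input nX → ℕ → List (Fin nX → Bool)
prefix X i = map X (upTo (suc i))

-- Induced trace: letter at index i is X_{i+1} ∪ σ(X₁⋯X_{i+1}) (end removed).
induced : ∀ {nX nY} → Strategy nX nY → Input nX → Trace nX nY
induced σ X i = [ X i , proj₁ (σ (prefix X i)) ]

-- end ∈ σ(X₁ ⋯ X_{i+1}), i.e. the induced finite trace has length i+1.
Ends : ∀ {nX nY} → Strategy nX nY → Input nX → ℕ → Set
Ends σ X i = proj₂ (σ (prefix X i)) ≡ true

IsStrategy : ∀ {nX nY} → Strategy nX nY → Set
IsStrategy σ = ∀ X → ∃[ i ] (Ends σ X i × (∀ j → Ends σ X j → j ≡ i))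

Winning : ∀ {nX nY} → Formula nX nY → Strategy nX nY → Set
Winning φ σ = IsStrategy σ
  × (∀ X i → Ends σ X i → SatF (suc i) (induced σ X) 0 φ)

Realizable : ∀ {nX nY} → Formula nX nY → Set
Realizable {nX} {nY} φ = ∃[ σ ] Winning {nX} {nY} φ σ

Bounded : ∀ {nX nY} → Strategy nX nY → Set
Bounded σ = ∃[ B ] (0 < B × (∀ X i → Ends σ X i → suc i ≤ B))

IsCStrategy : ∀ {nX nY} → Strategy nX nY → Set
IsCStrategy σ = ∀ X i j → Ends σ X i → Ends σ X j → i ≡ j

-- α-strategy: if end is never output, the induced infinite trace violates α
-- (classically equivalent to "end is output or α is violated").
IsαStrategy : ∀ {nX nY} → Formula nX nY → Strategy nX nY → Set
IsαStrategy α σ = IsCStrategy σ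
  × (∀ X → (∀ i → ¬ Ends σ X i) → ¬ SatI (induced σ X) 0 α)

CWinning : ∀ {nX nY} → Formula nX nY → Formula nX nY → Strategy nX nY → Set
CWinning α φ σ = IsαStrategy α σ
  × (∀ X i → Ends σ X i → SatF (suc i) (induced σ X) 0 φ)

CRealizable : ∀ {nX nY} → Formula nX nY → Formula nX nY → Set
CRealizable {nX} {nY} α φ = ∃[ σ ] CWinning {nX} {nY} α φ σ

module Submission where

-- The finite traces satisfying φ are recognised by a finite
-- deterministic automaton: the type of a position (truth values of all
-- subformulas there) is computed right to left by `stepType`, so a forward
-- automaton whose states are Boolean functions on types decides φ
-- (`recognises`).  On this automaton the controller's bounded attractor
-- `Win n` (acceptance can be forced within n+1 steps) grows with n and, the
-- state space being finite, becomes stationary at some N.  If the initial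
-- state lies in `Win N`, the attractor strategy wins in at most N+1 steps;
-- otherwise the environment keeps every play outside `Win N` forever and so
-- defeats any given strategy.  Hence a winning strategy yields a bounded one.
--
-- Second part.  With one input p, no outputs and α = φ = ◇p, waiting for p
-- wins, but a strategy bounded by B must violate α on the input where p first
-- holds at position B.

open import Defs
open import Data.Nat using (ℕ; zero; suc; _≤_; _<_; z≤n; s≤s; pred; _+_; _∸_; _≤?_)
open import Data.Nat.Properties
  using (≤-refl; <-irrefl; ≤-trans; ≤-antisym; ≤-pred; <⇒≱; n≤1+n; m<m+n; +-suc; +-identityʳ;
         m≤n⇒m<n∨m≡n; m∸n+n≡m)
open import Data.Bool using (Bool; true; false; not; _∧_; _∨_; if_then_else_)
import Data.Bool.Properties as Bool
open import Data.Unit using (⊤) renaming (tt to ⋆)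
import Data.Unit.Properties as Unit
open import Data.Empty using (⊥; ⊥-elim)
open import Data.Fin using (Fin; zero)
import Data.Fin.Properties as Fin
open import Data.Sum using (_⊎_; inj₁; inj₂; [_,_])
open import Data.Product using (_×_; _,_; proj₁; proj₂; ∃-syntax)
open import Data.Product.Properties using (≡-dec)
open import Data.List using (List; []; _∷_; map; _++_; allFin; cartesianProduct; applyUpTo)
open import Data.List.Properties using (map-upTo)
open import Data.Bool.ListAction using (all; any)
open import Data.List.Membership.Propositional using (_∈_)
open import Data.List.Membership.Propositional.Properties
  using (∈-map⁺; ∈-++⁺ˡ; ∈-++⁺ʳ; ∈-allFin; ∈-cartesianProduct⁺)
open import Data.List.Relation.Unary.Any using (here; there)
open import Function.Bundles using (_⇔_; mk⇔; Equivalence)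
open import Relation.Binary.Definitions using (DecidableEquality)
open import Relation.Binary.PropositionalEquality
  using (_≡_; _≢_; _≗_; refl; sym; trans; cong; cong₂; subst; module ≡-Reasoning)
open import Relation.Nullary using (¬_; yes; no)
open import Relation.Nullary.Decidable using (⌊_⌋)

open Equivalence using (to; from)

false≢true : false ≢ true
false≢true ()

∨-introˡ : ∀ {a b} → a ≡ true → a ∨ b ≡ true
∨-introˡ refl = refl

∨-introʳ : ∀ a {b} → b ≡ true → a ∨ b ≡ true
∨-introʳ true  _ = refl
∨-introʳ false e = e

∨-elim : ∀ a {b} → a ∨ b ≡ true → a ≡ true ⊎ b ≡ true
∨-elim true  _ = inj₁ refl
∨-elim false e = inj₂ e

∨-false : ∀ a {b} → a ∨ b ≡ false → a ≡ false × b ≡ false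
∨-false false e = refl , e

∧-intro : ∀ {a b} → a ≡ true → b ≡ true → a ∧ b ≡ true
∧-intro refl refl = refl

∧-elim : ∀ a {b} → a ∧ b ≡ true → a ≡ true × b ≡ true
∧-elim true e = refl , e

not-true : ∀ a → not a ≡ true ⇔ (a ≢ true)
not-true true  = mk⇔ (λ ()) (λ h → ⊥-elim (h refl))
not-true false = mk⇔ (λ _ ()) (λ _ → refl)

not-true⇒false : ∀ a → not a ≡ true → a ≡ false
not-true⇒false false _ = refl

module _ {A : Set} where

  all-sound : ∀ (p : A → Bool) l {a} → all p l ≡ true → a ∈ l → p a ≡ true
  all-sound p (b ∷ l) e (here refl) = proj₁ (∧-elim (p b) e)
  all-sound p (b ∷ l) e (there m)   = all-sound p l (proj₂ (∧-elim (p b) e)) m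

  any-false : ∀ (p : A → Bool) l {a} → any p l ≡ false → a ∈ l → p a ≡ false
  any-false p (b ∷ l) e (here refl) = proj₁ (∨-false (p b) e)
  any-false p (b ∷ l) e (there m)   = any-false p l (proj₂ (∨-false (p b) e)) m

  all-false : ∀ (p : A → Bool) l → all p l ≡ false → any (λ a → not (p a)) l ≡ true
  all-false p (a ∷ l) e with p a
  ... | true  = all-false p l e
  ... | false = refl

  all-cong : ∀ {p q : A → Bool} l → p ≗ q → all p l ≡ all q l
  all-cong []      h = refl
  all-cong (a ∷ l) h = cong₂ _∧_ (h a) (all-cong l h)

  any-cong : ∀ {p q : A → Bool} l → p ≗ q → any p l ≡ any q l
  any-cong []      h = refl
  any-cong (a ∷ l) h = cong₂ _∨_ (h a) (any-cong l h)

  all-mono : ∀ {p q : A → Bool} l → (∀ a → p a ≡ true → q a ≡ true)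
           → all p l ≡ true → all q l ≡ true
  all-mono []          h e = refl
  all-mono {p} (a ∷ l) h e with ∧-elim (p a) e
  ... | ea , el = ∧-intro (h a ea) (all-mono l h el)

  any-mono : ∀ {p q : A → Bool} l → (∀ a → p a ≡ true → q a ≡ true)
           → any p l ≡ true → any q l ≡ true
  any-mono {p} (a ∷ l) h e with ∨-elim (p a) e
  ... | inj₁ ea = ∨-introˡ (h a ea)
  ... | inj₂ el = ∨-introʳ _ (any-mono l h el)

  select : A → (A → Bool) → List A → A
  select d p []      = d
  select d p (a ∷ l) = if p a then a else select d p l

  select-sound : ∀ d (p : A → Bool) l → any p l ≡ true → p (select d p l) ≡ true
  select-sound d p (a ∷ l) e with p a in pa
  ... | true  = pa
  ... | false = select-sound d p l e

  module Stabilisation (P : ℕ → A → Bool)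
                       (mono : ∀ n a → P n a ≡ true → P (suc n) a ≡ true) where

    mono-≤ : ∀ {m n} a → m ≤ n → P m a ≡ true → P n a ≡ true
    mono-≤ {m} {n} a m≤n e =
      subst (λ k → P k a ≡ true) (m∸n+n≡m m≤n) (iterate (n ∸ m) e)
      where
      iterate : ∀ k → P m a ≡ true → P (k + m) a ≡ true
      iterate zero    e = e
      iterate (suc k) e = mono (k + m) a (iterate k e)

    stabilises : ∀ (l : List A) M →
      ∃[ N ] (M ≤ N × (∀ {a} → a ∈ l → P (suc N) a ≡ true → P N a ≡ true))
    stabilises []      M = M , ≤-refl , λ ()
    -- after stabilising on l at N, either a is already stable at N, or
    -- a ∈ P (N+1) and then a ∈ P N′ for every later stabilisation point N′
    stabilises (a ∷ l) M with stabilises l M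
    ... | N , M≤N , stable-l with P N a in eN | P (suc N) a in eN′
    ...   | true  | _     = N , M≤N , λ { (here refl) _ → eN ; (there m) → stable-l m }
    ...   | false | false = N , M≤N , λ { (here refl) e → ⊥-elim (false≢true (trans (sym eN′) e))
                                          ; (there m) → stable-l m }
    ...   | false | true with stabilises l (suc N)
    ...     | N′ , N<N′ , stable-l′ =
      N′ , ≤-trans M≤N (≤-trans (n≤1+n N) N<N′) ,
      λ { (here refl) _ → mono-≤ a N<N′ eN′ ; (there m) → stable-l′ m }

module BooleanFunctions {A : Set} (_≟_ : DecidableEquality A) where

  update : A → Bool → (A → Bool) → A → Bool
  update a b f t = if ⌊ t ≟ a ⌋ then b else f t

  update-here : ∀ a b f → update a b f a ≡ b
  update-here a b f with a ≟ a
  ... | yes _  = refl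
  ... | no a≢a = ⊥-elim (a≢a refl)

  functions : List A → List (A → Bool)
  functions []      = (λ _ → false) ∷ []
  functions (a ∷ l) = map (update a true) (functions l) ++ map (update a false) (functions l)

  functions-complete : ∀ l (f : A → Bool) →
    ∃[ f′ ] (f′ ∈ functions l × (∀ {t} → t ∈ l → f t ≡ f′ t))
  functions-complete []      f = (λ _ → false) , here refl , λ ()
  functions-complete (a ∷ l) f with functions-complete l f | f a in fa
  ... | f′ , m , agree | b = update a b f′ , member b , agree′
    where
    member : ∀ b → update a b f′ ∈ functions (a ∷ l)
    member true  = ∈-++⁺ˡ (∈-map⁺ (update a true) m)
    member false = ∈-++⁺ʳ (map (update a true) (functions l)) (∈-map⁺ (update a false) m)
    agree′ : ∀ {t} → t ∈ a ∷ l → f t ≡ update a b f′ t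
    agree′ (here refl) = trans fa (sym (update-here a b f′))
    agree′ {t} (there m′) with t ≟ a
    ... | yes refl = fa
    ... | no _     = agree m′

  functions-listing : ∀ l → (∀ t → t ∈ l) → (f : A → Bool) →
    ∃[ f′ ] (f′ ∈ functions l × f ≗ f′)
  functions-listing l complete f with functions-complete l f
  ... | f′ , m , agree = f′ , m , λ t → agree (complete t)

module Evaluation {nX nY : ℕ} where

  Fm : Set
  Fm = Formula nX nY

  -- `holds φ w i n`: φ holds at position i of the finite trace w of length
  -- i + n + 1, computed backwards from the last position.
  holds : Fm → Trace nX nY → ℕ → ℕ → Bool
  holds tt       w i n       = true
  holds (atom v) w i n       = w i v
  holds (¬' φ)   w i n       = not (holds φ w i n)
  holds (φ ∧' ψ) w i n       = holds φ w i n ∧ holds ψ w i n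
  holds (◯ φ)    w i zero    = false
  holds (◯ φ)    w i (suc n) = holds φ w (suc i) n
  holds (φ U ψ)  w i zero    = holds ψ w i zero
  holds (φ U ψ)  w i (suc n) = holds ψ w i (suc n) ∨ (holds φ w i (suc n) ∧ holds (φ U ψ) w (suc i) n)

  Sound : Fm → Set
  Sound φ = ∀ w len i n → len ≡ i + suc n → holds φ w i n ≡ true ⇔ SatF len w i φ

  private
    last-position : ∀ {len j} i n → len ≡ i + suc n → j < len → j ≤ i + n
    last-position {j = j} i n e j<len = ≤-pred (subst (suc j ≤_) (trans e (+-suc i n)) j<len)

    in-range : ∀ {len} i n → len ≡ i + suc n → i < len
    in-range i n e = subst (i <_) (sym e) (m<m+n i (s≤s z≤n))

  -- Until unfolds as ψ ∨ (φ ∧ ◯(φ U ψ)); its soundness is by induction on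
  -- the remaining length n.
  until-sound : ∀ φ ψ → Sound φ → Sound ψ → Sound (φ U ψ)
  until-sound φ ψ sφ sψ w len i zero e = mk⇔ now only-now
    where
    now : holds ψ w i 0 ≡ true → SatF len w i (φ U ψ)
    now h = i , ≤-refl , in-range i 0 e , to (sψ w len i 0 e) h , λ k i≤k k<i → ⊥-elim (<⇒≱ k<i i≤k)
    only-now : SatF len w i (φ U ψ) → holds ψ w i 0 ≡ true
    only-now (j , i≤j , j<len , ψj , _) = from (sψ w len i 0 e) (subst (λ k → SatF len w k ψ) j≡i ψj)
      where
      j≡i : j ≡ i
      j≡i = ≤-antisym (subst (j ≤_) (+-identityʳ i) (last-position i 0 e j<len)) i≤j
  until-sound φ ψ sφ sψ w len i (suc n) e = mk⇔ unfold fold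
    where
    e′ : len ≡ suc i + suc n
    e′ = trans e (+-suc i (suc n))
    later : holds (φ U ψ) w (suc i) n ≡ true ⇔ SatF len w (suc i) (φ U ψ)
    later = until-sound φ ψ sφ sψ w len (suc i) n e′
    unfold : holds (φ U ψ) w i (suc n) ≡ true → SatF len w i (φ U ψ)
    unfold h with ∨-elim (holds ψ w i (suc n)) h
    ... | inj₁ ψi = i , ≤-refl , in-range i (suc n) e , to (sψ w len i (suc n) e) ψi ,
                    λ k i≤k k<i → ⊥-elim (<⇒≱ k<i i≤k)
    ... | inj₂ h′ with ∧-elim (holds φ w i (suc n)) h′
    ...   | φi , rest with to later rest
    ...     | j , i<j , j<len , ψj , φ-before = j , ≤-trans (n≤1+n i) i<j , j<len , ψj , φ-before′
      where
      φ-before′ : ∀ k → i ≤ k → k < j → SatF len w k φ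
      φ-before′ k i≤k k<j with m≤n⇒m<n∨m≡n i≤k
      ... | inj₁ i<k  = φ-before k i<k k<j
      ... | inj₂ refl = to (sφ w len i (suc n) e) φi
    fold : SatF len w i (φ U ψ) → holds (φ U ψ) w i (suc n) ≡ true
    fold (j , i≤j , j<len , ψj , φ-before) with m≤n⇒m<n∨m≡n i≤j
    ... | inj₂ refl = ∨-introˡ (from (sψ w len i (suc n) e) ψj)
    ... | inj₁ i<j  = ∨-introʳ _ (∧-intro (from (sφ w len i (suc n) e) (φ-before i ≤-refl i<j))
                        (from later (j , i<j , j<len , ψj ,
                                     λ k i<k k<j → φ-before k (≤-trans (n≤1+n i) i<k) k<j)))

  holds-sound : ∀ φ → Sound φ
  holds-sound tt       w len i n e = mk⇔ (λ _ → ⋆) (λ _ → refl)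
  holds-sound (atom v) w len i n e = mk⇔ (λ h → h) (λ h → h)
  holds-sound (¬' φ)   w len i n e =
    mk⇔ (λ h s → to (not-true _) h (from (holds-sound φ w len i n e) s))
        (λ h → from (not-true _) (λ t → h (to (holds-sound φ w len i n e) t)))
  holds-sound (φ ∧' ψ) w len i n e =
    mk⇔ (λ h → let (hφ , hψ) = ∧-elim _ h in to (holds-sound φ w len i n e) hφ , to (holds-sound ψ w len i n e) hψ)
        (λ (sφ , sψ) → ∧-intro (from (holds-sound φ w len i n e) sφ) (from (holds-sound ψ w len i n e) sψ))
  holds-sound (◯ φ) w len i zero e =
    mk⇔ (λ ()) (λ (i+1<len , _) → ⊥-elim (<-irrefl refl (subst (suc i ≤_) (+-identityʳ i) (last-position i 0 e i+1<len))))
  holds-sound (◯ φ) w len i (suc n) e =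
    mk⇔ (λ h → in-range (suc i) n e′ , to (holds-sound φ w len (suc i) n e′) h)
        (λ (_ , s) → from (holds-sound φ w len (suc i) n e′) s)
    where
    e′ : len ≡ suc i + suc n
    e′ = trans e (+-suc i (suc n))
  holds-sound (φ U ψ) = until-sound φ ψ (holds-sound φ) (holds-sound ψ)

-- The type of a position: the truth values of all subformulas of φ there.
-- Types are computed right to left by a deterministic step function, which
-- makes the set of satisfying traces recognisable by a finite automaton.
module Types {nX nY : ℕ} where

  open Evaluation {nX} {nY}

  Sub : Fm → Set
  Ty  : Fm → Set
  Ty φ = Bool × Sub φ
  Sub tt       = ⊤
  Sub (atom v) = ⊤
  Sub (¬' φ)   = Ty φ
  Sub (φ ∧' ψ) = Ty φ × Ty ψ
  Sub (◯ φ)    = Ty φ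
  Sub (φ U ψ)  = Ty φ × Ty ψ

  typeAt : ∀ φ → Trace nX nY → ℕ → ℕ → Ty φ
  subtypesAt : ∀ φ → Trace nX nY → ℕ → ℕ → Sub φ
  typeAt φ w i n = holds φ w i n , subtypesAt φ w i n
  subtypesAt tt       w i n = ⋆
  subtypesAt (atom v) w i n = ⋆
  subtypesAt (¬' φ)   w i n = typeAt φ w i n
  subtypesAt (φ ∧' ψ) w i n = typeAt φ w i n , typeAt ψ w i n
  subtypesAt (◯ φ)    w i n = typeAt φ w i n
  subtypesAt (φ U ψ)  w i n = typeAt φ w i n , typeAt ψ w i n

  lastType : ∀ φ → Letter nX nY → Ty φ
  lastType tt       a = true , ⋆
  lastType (atom v) a = a v , ⋆
  lastType (¬' φ)   a = not (proj₁ (lastType φ a)) , lastType φ a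
  lastType (φ ∧' ψ) a = proj₁ (lastType φ a) ∧ proj₁ (lastType ψ a) , lastType φ a , lastType ψ a
  lastType (◯ φ)    a = false , lastType φ a
  lastType (φ U ψ)  a = proj₁ (lastType ψ a) , lastType φ a , lastType ψ a

  stepType : ∀ φ → Letter nX nY → Ty φ → Ty φ
  stepType tt       a t = true , ⋆
  stepType (atom v) a t = a v , ⋆
  stepType (¬' φ)   a (_ , t) = not (proj₁ (stepType φ a t)) , stepType φ a t
  stepType (φ ∧' ψ) a (_ , t , u) =
    proj₁ (stepType φ a t) ∧ proj₁ (stepType ψ a u) , stepType φ a t , stepType ψ a u
  stepType (◯ φ)    a (_ , t) = proj₁ t , stepType φ a t
  stepType (φ U ψ)  a (b , t , u) =
    proj₁ (stepType ψ a u) ∨ (proj₁ (stepType φ a t) ∧ b) , stepType φ a t , stepType ψ a u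

  typeAt-last : ∀ φ w i → typeAt φ w i 0 ≡ lastType φ (w i)
  typeAt-last tt       w i = refl
  typeAt-last (atom v) w i = refl
  typeAt-last (¬' φ)   w i = cong (λ t → not (proj₁ t) , t) (typeAt-last φ w i)
  typeAt-last (φ ∧' ψ) w i =
    cong₂ (λ t u → proj₁ t ∧ proj₁ u , t , u) (typeAt-last φ w i) (typeAt-last ψ w i)
  typeAt-last (◯ φ)    w i = cong (false ,_) (typeAt-last φ w i)
  typeAt-last (φ U ψ)  w i =
    cong₂ (λ t u → proj₁ u , t , u) (typeAt-last φ w i) (typeAt-last ψ w i)

  typeAt-step : ∀ φ w i n → typeAt φ w i (suc n) ≡ stepType φ (w i) (typeAt φ w (suc i) n)
  typeAt-step tt       w i n = refl
  typeAt-step (atom v) w i n = refl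
  typeAt-step (¬' φ)   w i n = cong (λ t → not (proj₁ t) , t) (typeAt-step φ w i n)
  typeAt-step (φ ∧' ψ) w i n =
    cong₂ (λ t u → proj₁ t ∧ proj₁ u , t , u) (typeAt-step φ w i n) (typeAt-step ψ w i n)
  typeAt-step (◯ φ)    w i n = cong (holds φ w (suc i) n ,_) (typeAt-step φ w i n)
  typeAt-step (φ U ψ)  w i n =
    cong₂ (λ t u → proj₁ u ∨ (proj₁ t ∧ holds (φ U ψ) w (suc i) n) , t , u)
          (typeAt-step φ w i n) (typeAt-step ψ w i n)

  typeAt-shift : ∀ φ w k n → typeAt φ w (suc k) n ≡ typeAt φ (λ j → w (suc j)) k n
  typeAt-shift φ w k zero    = trans (typeAt-last φ w (suc k)) (sym (typeAt-last φ _ k))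
  typeAt-shift φ w k (suc n) =
    trans (typeAt-step φ w (suc k) n)
          (trans (cong (stepType φ (w (suc k))) (typeAt-shift φ w (suc k) n))
                 (sym (typeAt-step φ _ k n)))

  lastType-cong : ∀ φ {a a′ : Letter nX nY} → a ≗ a′ → lastType φ a ≡ lastType φ a′
  lastType-cong tt       h = refl
  lastType-cong (atom v) h = cong (_, ⋆) (h v)
  lastType-cong (¬' φ)   h = cong (λ t → not (proj₁ t) , t) (lastType-cong φ h)
  lastType-cong (φ ∧' ψ) h = cong₂ (λ t u → proj₁ t ∧ proj₁ u , t , u) (lastType-cong φ h) (lastType-cong ψ h)
  lastType-cong (◯ φ)    h = cong (false ,_) (lastType-cong φ h)
  lastType-cong (φ U ψ)  h = cong₂ (λ t u → proj₁ u , t , u) (lastType-cong φ h) (lastType-cong ψ h)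

  stepType-cong : ∀ φ {a a′ : Letter nX nY} → a ≗ a′ → ∀ t → stepType φ a t ≡ stepType φ a′ t
  stepType-cong tt       h t = refl
  stepType-cong (atom v) h t = cong (_, ⋆) (h v)
  stepType-cong (¬' φ)   h (_ , t) = cong (λ t → not (proj₁ t) , t) (stepType-cong φ h t)
  stepType-cong (φ ∧' ψ) h (_ , t , u) =
    cong₂ (λ t u → proj₁ t ∧ proj₁ u , t , u) (stepType-cong φ h t) (stepType-cong ψ h u)
  stepType-cong (◯ φ)    h (_ , t) = cong (proj₁ t ,_) (stepType-cong φ h t)
  stepType-cong (φ U ψ)  h (b , t , u) =
    cong₂ (λ t u → proj₁ u ∨ (proj₁ t ∧ b) , t , u) (stepType-cong φ h t) (stepType-cong ψ h u)

  _≟Ty_ : ∀ {φ} → DecidableEquality (Ty φ)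
  _≟Sub_ : ∀ {φ} → DecidableEquality (Sub φ)
  _≟Ty_ = ≡-dec Bool._≟_ _≟Sub_
  _≟Sub_ {tt}     = Unit._≟_
  _≟Sub_ {atom v} = Unit._≟_
  _≟Sub_ {¬' φ}   = _≟Ty_ {φ}
  _≟Sub_ {φ ∧' ψ} = ≡-dec (_≟Ty_ {φ}) (_≟Ty_ {ψ})
  _≟Sub_ {◯ φ}    = _≟Ty_ {φ}
  _≟Sub_ {φ U ψ}  = ≡-dec (_≟Ty_ {φ}) (_≟Ty_ {ψ})

  allTypes : ∀ φ → List (Ty φ)
  allSubs  : ∀ φ → List (Sub φ)
  allTypes φ = cartesianProduct (true ∷ false ∷ []) (allSubs φ)
  allSubs tt       = ⋆ ∷ []
  allSubs (atom v) = ⋆ ∷ []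
  allSubs (¬' φ)   = allTypes φ
  allSubs (φ ∧' ψ) = cartesianProduct (allTypes φ) (allTypes ψ)
  allSubs (◯ φ)    = allTypes φ
  allSubs (φ U ψ)  = cartesianProduct (allTypes φ) (allTypes ψ)

  allTypes-complete : ∀ φ t → t ∈ allTypes φ
  allSubs-complete  : ∀ φ s → s ∈ allSubs φ
  allTypes-complete φ (b , s) = ∈-cartesianProduct⁺ (bool∈ b) (allSubs-complete φ s)
    where
    bool∈ : ∀ b → b ∈ true ∷ false ∷ []
    bool∈ true  = here refl
    bool∈ false = there (here refl)
  allSubs-complete tt       ⋆ = here refl
  allSubs-complete (atom v) ⋆ = here refl
  allSubs-complete (¬' φ)   t = allTypes-complete φ t
  allSubs-complete (φ ∧' ψ) (t , u) = ∈-cartesianProduct⁺ (allTypes-complete φ t) (allTypes-complete ψ u)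
  allSubs-complete (◯ φ)    t = allTypes-complete φ t
  allSubs-complete (φ U ψ)  (t , u) = ∈-cartesianProduct⁺ (allTypes-complete φ t) (allTypes-complete ψ u)

module Game {nX nY : ℕ} (φ : Formula nX nY) where

  open Evaluation {nX} {nY}
  open Types {nX} {nY}

  -- A state is a Boolean function on types.  After reading a prefix of a
  -- trace w, it maps the type of the next position to the truth value of φ
  -- at position 0 of w (`afterReading-correct`).
  State : Set
  State = Ty φ → Bool

  initial : State
  initial = proj₁

  δ : State → Letter nX nY → State
  δ S a t = S (stepType φ a t)

  accepting : State → Letter nX nY → Bool
  accepting S a = S (lastType φ a)

  afterReading : State → Trace nX nY → ℕ → State
  afterReading S w zero    = S
  afterReading S w (suc k) = afterReading (δ S (w 0)) (λ j → w (suc j)) k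

  afterReading-correct : ∀ S w k n → afterReading S w k (typeAt φ w k n) ≡ S (typeAt φ w 0 (k + n))
  afterReading-correct S w zero    n = refl
  afterReading-correct S w (suc k) n = begin
    afterReading (δ S (w 0)) w′ k (typeAt φ w (suc k) n)
      ≡⟨ cong (afterReading (δ S (w 0)) w′ k) (typeAt-shift φ w k n) ⟩
    afterReading (δ S (w 0)) w′ k (typeAt φ w′ k n)
      ≡⟨ afterReading-correct (δ S (w 0)) w′ k n ⟩
    S (stepType φ (w 0) (typeAt φ w′ 0 (k + n)))
      ≡⟨ cong (λ t → S (stepType φ (w 0) t)) (sym (typeAt-shift φ w 0 (k + n))) ⟩
    S (stepType φ (w 0) (typeAt φ w 1 (k + n)))
      ≡⟨ cong S (sym (typeAt-step φ w 0 (k + n))) ⟩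
    S (typeAt φ w 0 (suc k + n)) ∎
    where
    open ≡-Reasoning
    w′ : Trace nX nY
    w′ j = w (suc j)

  afterReading-cong : ∀ {w w′ : Trace nX nY} → (∀ i → w i ≡ w′ i) → ∀ k {S S′} → S ≗ S′ →
                      afterReading S w k ≗ afterReading S′ w′ k
  afterReading-cong hw zero    hS = hS
  afterReading-cong hw (suc k) {S′ = S′} hS =
    afterReading-cong (λ i → hw (suc i)) k (λ t → trans (hS _) (cong (λ a → S′ (stepType φ a t)) (hw 0)))

  acceptsAt : State → Trace nX nY → ℕ → Bool
  acceptsAt S w e = accepting (afterReading S w e) (w e)

  acceptsAt-cong : ∀ {w w′ : Trace nX nY} → (∀ i → w i ≡ w′ i) → ∀ S e → acceptsAt S w e ≡ acceptsAt S w′ e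
  acceptsAt-cong hw S e =
    trans (afterReading-cong hw e (λ _ → refl) _) (cong (afterReading S _ e) (cong (lastType φ) (hw e)))

  recognises : ∀ w e → SatF (suc e) w 0 φ ⇔ acceptsAt initial w e ≡ true
  recognises w e = mk⇔ (λ s → trans read (from sound s)) (λ h → to sound (trans (sym read) h))
    where
    sound : holds φ w 0 (e + 0) ≡ true ⇔ SatF (suc e) w 0 φ
    sound = holds-sound φ w (suc e) 0 (e + 0) (cong suc (sym (+-identityʳ e)))
    read : acceptsAt initial w e ≡ holds φ w 0 (e + 0)
    read = trans (cong (afterReading initial w e) (sym (typeAt-last φ w e))) (afterReading-correct initial w e 0)

  InputSet OutputSet : Set
  InputSet  = Fin nX → Bool
  OutputSet = Fin nY → Bool

  letter : InputSet → OutputSet → Letter nX nY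
  letter x y = [ x , y ]

  letter-congˡ : ∀ {x x′} y → x ≗ x′ → letter x y ≗ letter x′ y
  letter-congˡ y h (inj₁ v) = h v
  letter-congˡ y h (inj₂ v) = refl

  letter-congʳ : ∀ x {y y′} → y ≗ y′ → letter x y ≗ letter x y′
  letter-congʳ x h (inj₁ v) = refl
  letter-congʳ x h (inj₂ v) = h v

  module Inputs  = BooleanFunctions (Fin._≟_ {nX})
  module Outputs = BooleanFunctions (Fin._≟_ {nY})

  inputs : List InputSet
  inputs = Inputs.functions (allFin nX)

  inputs-complete : ∀ x → ∃[ x′ ] (x′ ∈ inputs × x ≗ x′)
  inputs-complete = Inputs.functions-listing (allFin nX) ∈-allFin

  outputs : List OutputSet
  outputs = Outputs.functions (allFin nY)

  outputs-complete : ∀ y → ∃[ y′ ] (y′ ∈ outputs × y ≗ y′)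
  outputs-complete = Outputs.functions-listing (allFin nY) ∈-allFin

  -- `Win n S`: from S the controller can force acceptance within n+1 steps;
  -- `forces n S a`: the letter a, read in S, accepts or leads to a state
  -- from which acceptance can be forced within n further steps.
  forces : ℕ → State → Letter nX nY → Bool
  Win    : ℕ → State → Bool
  forces zero    S a = accepting S a
  forces (suc n) S a = accepting S a ∨ Win n (δ S a)
  Win n S = all (λ x → any (λ y → forces n S (letter x y)) outputs) inputs

  Win-cong    : ∀ n {S S′} → S ≗ S′ → Win n S ≡ Win n S′
  forces-cong : ∀ n {S S′} → S ≗ S′ → ∀ a → forces n S a ≡ forces n S′ a
  forces-cong zero    hS a = hS _
  forces-cong (suc n) hS a = cong₂ _∨_ (hS _) (Win-cong n (λ t → hS _))
  Win-cong n hS = all-cong inputs (λ x → any-cong outputs (λ y → forces-cong n hS (letter x y)))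

  forces-letter : ∀ n S {a a′} → a ≗ a′ → forces n S a ≡ forces n S a′
  forces-letter zero    S h = cong S (lastType-cong φ h)
  forces-letter (suc n) S h =
    cong₂ _∨_ (cong S (lastType-cong φ h)) (Win-cong n (λ t → cong S (stepType-cong φ h t)))

  Win-mono    : ∀ n S → Win n S ≡ true → Win (suc n) S ≡ true
  forces-mono : ∀ n S a → forces n S a ≡ true → forces (suc n) S a ≡ true
  forces-mono zero    S a e = ∨-introˡ e
  forces-mono (suc n) S a e with ∨-elim (accepting S a) e
  ... | inj₁ acc = ∨-introˡ acc
  ... | inj₂ win = ∨-introʳ _ (Win-mono n _ win)
  Win-mono n S = all-mono inputs (λ x → any-mono outputs (λ y → forces-mono n S (letter x y)))

  module States = BooleanFunctions (_≟Ty_ {φ})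

  states : List State
  states = States.functions (allTypes φ)

  states-complete : ∀ S → ∃[ S′ ] (S′ ∈ states × S ≗ S′)
  states-complete = States.functions-listing (allTypes φ) (allTypes-complete φ)

  -- There are finitely many states up to pointwise equality, so the
  -- increasing chain Win 0 ⊆ Win 1 ⊆ … becomes stationary.
  Win-stabilises : ∃[ N ] (∀ S → Win (suc N) S ≡ true → Win N S ≡ true)
  Win-stabilises with Stabilisation.stabilises Win Win-mono states 0
  ... | N , _ , stable = N , λ S → stationary (states-complete S)
    where
    stationary : ∀ {S} → ∃[ S′ ] (S′ ∈ states × S ≗ S′) → Win (suc N) S ≡ true → Win N S ≡ true
    stationary (S′ , m , S≗S′) win =
      trans (Win-cong N S≗S′) (stable m (trans (sym (Win-cong (suc N) S≗S′)) win))

  noInput : InputSet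
  noInput _ = false

  noOutput : OutputSet
  noOutput _ = false

  choose : ℕ → State → InputSet → OutputSet
  choose n S x = select noOutput (λ y → forces n S (letter x y)) outputs

  choose-forces : ∀ n S → Win n S ≡ true → ∀ x → forces n S (letter x (choose n S x)) ≡ true
  choose-forces n S win x with inputs-complete x
  ... | x′ , m , x≗x′ = select-sound noOutput _ outputs
          (trans (any-cong outputs (λ y → forces-letter n S (letter-congˡ y x≗x′)))
                 (all-sound _ inputs win m))

  spoil : ℕ → State → InputSet
  spoil n S = select noInput (λ x → not (any (λ y → forces n S (letter x y)) outputs)) inputs

  spoil-defeats : ∀ n S → Win n S ≡ false → ∀ y → forces n S (letter (spoil n S) y) ≡ false
  spoil-defeats n S lose y with outputs-complete y
  ... | y′ , m , y≗y′ = trans (forces-letter n S (letter-congʳ _ y≗y′))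
          (any-false _ outputs (not-true⇒false _ (select-sound noInput _ inputs (all-false _ inputs lose))) m)

  -- The attractor strategy with budget k: answer by `choose k`, output
  -- `end` as soon as the current letter is accepted, and decrease the budget.
  respond : ℕ → State → InputSet → List InputSet → OutputSet × Bool
  respond k S x []        = choose k S x , accepting S (letter x (choose k S x))
  respond k S x (x′ ∷ xs) =
    if accepting S (letter x (choose k S x)) then (noOutput , false)
    else respond (pred k) (δ S (letter x (choose k S x))) x′ xs

  controller : ℕ → Strategy nX nY
  controller N []       = noOutput , false
  controller N (x ∷ xs) = respond N initial x xs

  reply : ℕ → State → Input nX → ℕ → OutputSet × Bool
  reply k S X j = respond k S (X 0) (applyUpTo (λ i → X (suc i)) j)

  play : ℕ → State → Input nX → Trace nX nY
  play k S X i = letter (X i) (proj₁ (reply k S X i))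

  controller-reply : ∀ N X i → controller N (prefix X i) ≡ reply N initial X i
  controller-reply N X i = cong (controller N) (map-upTo X (suc i))

  private
    firstAccepted : ℕ → State → Input nX → Bool
    firstAccepted k S X = accepting S (letter (X 0) (choose k S (X 0)))

    reply-stopped : ∀ k S X j → firstAccepted k S X ≡ true → reply k S X (suc j) ≡ (noOutput , false)
    reply-stopped k S X j acc rewrite acc = refl

    reply-continues : ∀ k S X j → firstAccepted k S X ≡ false →
      reply k S X (suc j) ≡ reply (pred k) (δ S (play k S X 0)) (λ i → X (suc i)) j
    reply-continues k S X j rej rewrite rej = refl

  EndsAcceptingAt : ℕ → State → Input nX → ℕ → Set
  EndsAcceptingAt k S X e = proj₂ (reply k S X e) ≡ true
    × (∀ j → proj₂ (reply k S X j) ≡ true → j ≡ e)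
    × acceptsAt S (play k S X) e ≡ true

  attractor-wins : ∀ k S X → Win k S ≡ true → ∃[ e ] (e ≤ k × EndsAcceptingAt k S X e)
  attractor-wins k S X win with firstAccepted k S X in acc
  ... | true = 0 , z≤n , acc , only-now , acc
    where
    only-now : ∀ j → proj₂ (reply k S X j) ≡ true → j ≡ 0
    only-now zero    _ = refl
    only-now (suc j) h = ⊥-elim (false≢true (trans (sym (cong proj₂ (reply-stopped k S X j acc))) h))
  attractor-wins zero S X win | false =
    ⊥-elim (false≢true (trans (sym acc) (choose-forces zero S win (X 0))))
  attractor-wins (suc k) S X win | false with ∨-elim (firstAccepted (suc k) S X) (choose-forces (suc k) S win (X 0))
  ... | inj₁ acc′ = ⊥-elim (false≢true (trans (sym acc) acc′))
  ... | inj₂ win′ with attractor-wins k (δ S (play (suc k) S X 0)) (λ i → X (suc i)) win′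
  ...   | e , e≤k , ends , once , accepts =
    suc e , s≤s e≤k , trans (cong proj₂ (reply-continues (suc k) S X e acc)) ends , once′ , accepts′
    where
    shifted : ∀ j → play (suc k) S X (suc j) ≡ play k (δ S (play (suc k) S X 0)) (λ i → X (suc i)) j
    shifted j = cong (λ r → letter (X (suc j)) (proj₁ r)) (reply-continues (suc k) S X j acc)
    once′ : ∀ j → proj₂ (reply (suc k) S X j) ≡ true → j ≡ suc e
    once′ zero    h = ⊥-elim (false≢true (trans (sym acc) h))
    once′ (suc j) h = cong suc (once j (trans (sym (cong proj₂ (reply-continues (suc k) S X j acc))) h))
    accepts′ : acceptsAt S (play (suc k) S X) (suc e) ≡ true
    accepts′ = trans (acceptsAt-cong shifted _ e) accepts

  controller-wins : ∀ N → Win N initial ≡ true → Winning φ (controller N) × Bounded (controller N)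
  controller-wins N win = (isStrategy , wins) , suc N , s≤s z≤n , λ X i ends → s≤s (proj₁ (endpoint X i ends))
    where
    endFlag : ∀ X i → proj₂ (controller N (prefix X i)) ≡ proj₂ (reply N initial X i)
    endFlag X i = cong proj₂ (controller-reply N X i)
    same : ∀ X i → induced (controller N) X i ≡ play N initial X i
    same X i = cong (λ r → letter (X i) (proj₁ r)) (controller-reply N X i)
    endpoint : ∀ X i → Ends (controller N) X i → i ≤ N × acceptsAt initial (induced (controller N) X) i ≡ true
    endpoint X i ends with attractor-wins N initial X win
    ... | e , e≤N , _ , once , accepts with once i (trans (sym (endFlag X i)) ends)
    ... | refl = e≤N , trans (acceptsAt-cong (same X) initial i) accepts
    isStrategy : IsStrategy (controller N)
    isStrategy X with attractor-wins N initial X win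
    ... | e , _ , ends , once , _ = e , trans (endFlag X e) ends , λ j h → once j (trans (sym (endFlag X j)) h)
    wins : ∀ X i → Ends (controller N) X i → SatF (suc i) (induced (controller N) X) 0 φ
    wins X i ends = from (recognises (induced (controller N) X) i) (proj₂ (endpoint X i ends))

  -- Against a strategy τ, the environment moves from S by `spoil (suc N)`
  -- and continues against τ restricted to histories extending that move.
  spoilingInput : ℕ → State → Strategy nX nY → Input nX
  spoilingInput N S τ zero    = spoil (suc N) S
  spoilingInput N S τ (suc i) =
    spoilingInput N (δ S (letter x (proj₁ (τ (x ∷ []))))) (λ h → τ (x ∷ h)) i
    where
    x : InputSet
    x = spoil (suc N) S

  spoiledTrace : ℕ → State → Strategy nX nY → Trace nX nY
  spoiledTrace N S τ i = letter (spoilingInput N S τ i) (proj₁ (τ (applyUpTo (spoilingInput N S τ) (suc i))))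

  module Stationary (N : ℕ) (stable : ∀ S → Win (suc N) S ≡ true → Win N S ≡ true) where

    Win-suc-false : ∀ S → Win N S ≡ false → Win (suc N) S ≡ false
    Win-suc-false S lose with Win (suc N) S in win
    ... | true  = ⊥-elim (false≢true (trans (sym lose) (stable S win)))
    ... | false = refl

    -- Outside the winning region Win N, the spoiling environment never lets
    -- the run accept and keeps it outside the region.
    spoiled : ∀ e S τ → Win N S ≡ false → acceptsAt S (spoiledTrace N S τ) e ≡ false
    spoiled zero    S τ lose = proj₁ (∨-false _ (spoil-defeats (suc N) S (Win-suc-false S lose) _))
    spoiled (suc e) S τ lose =
      spoiled e _ (λ h → τ (spoil (suc N) S ∷ h)) (proj₂ (∨-false _ (spoil-defeats (suc N) S (Win-suc-false S lose) _)))

    winning⇒Win : ∀ {σ} → Winning φ σ → Win N initial ≡ true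
    winning⇒Win {σ} (isStrategy , wins) with Win N initial in win
    ... | true  = refl
    ... | false = ⊥-elim (false≢true (trans (sym (spoiled e initial σ win)) accepts))
      where
      X : Input nX
      X = spoilingInput N initial σ
      e : ℕ
      e = proj₁ (isStrategy X)
      same : ∀ i → induced σ X i ≡ spoiledTrace N initial σ i
      same i = cong (λ h → letter (X i) (proj₁ (σ h))) (map-upTo X (suc i))
      accepts : acceptsAt initial (spoiledTrace N initial σ) e ≡ true
      accepts = trans (sym (acceptsAt-cong same initial e))
                      (to (recognises (induced σ X) e) (wins X e (proj₁ (proj₂ (isStrategy X)))))

  realizable⇒bounded : Realizable φ → ∃[ σ ] (Winning φ σ × Bounded σ)
  realizable⇒bounded (σ , winning) with Win-stabilises
  ... | N , stable = controller N , controller-wins N (Stationary.winning⇒Win N stable {σ} winning)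

p : Var 1 0
p = inj₁ zero

eventually-p : Formula 1 0
eventually-p = tt U atom p

firstP : List (Fin 1 → Bool) → Bool
firstP []           = false
firstP (x ∷ [])     = x zero
firstP (x ∷ x′ ∷ h) = not (x zero) ∧ firstP (x′ ∷ h)

waitForP : Strategy 1 0
waitForP h = (λ ()) , firstP h

firstPAt : Input 1 → ℕ → Bool
firstPAt X i = firstP (applyUpTo X (suc i))

ends-firstP : ∀ X i → Ends waitForP X i ≡ (firstPAt X i ≡ true)
ends-firstP X i = cong (λ h → firstP h ≡ true) (map-upTo X (suc i))

firstPAt-unique : ∀ X i j → firstPAt X i ≡ true → firstPAt X j ≡ true → i ≡ j
firstPAt-unique X zero    zero    _ _ = refl
firstPAt-unique X zero    (suc j) a b = ⊥-elim (to (not-true _) (proj₁ (∧-elim _ b)) a)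
firstPAt-unique X (suc i) zero    a b = ⊥-elim (to (not-true _) (proj₁ (∧-elim _ a)) b)
firstPAt-unique X (suc i) (suc j) a b =
  cong suc (firstPAt-unique (λ k → X (suc k)) i j (proj₂ (∧-elim _ a)) (proj₂ (∧-elim _ b)))

firstPAt-holds : ∀ X i → firstPAt X i ≡ true → X i zero ≡ true
firstPAt-holds X zero    a = a
firstPAt-holds X (suc i) a = firstPAt-holds (λ k → X (suc k)) i (proj₂ (∧-elim _ a))

firstPAt-exists : ∀ X j → X j zero ≡ true → ∃[ i ] (firstPAt X i ≡ true)
firstPAt-exists X zero    h = 0 , h
firstPAt-exists X (suc j) h with X 0 zero in e
... | true  = 0 , e
... | false with firstPAt-exists (λ k → X (suc k)) j h
...   | i , first = suc i , first′
  where
  first′ : firstPAt X (suc i) ≡ true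
  first′ rewrite e = first

waitForP-wins : CWinning eventually-p eventually-p waitForP
waitForP-wins = (once , never-ends-never-p) , ends-in-p
  where
  firstP⇒ : ∀ X i → Ends waitForP X i → firstPAt X i ≡ true
  firstP⇒ X i h rewrite ends-firstP X i = h
  once : IsCStrategy waitForP
  once X i j a b = firstPAt-unique X i j (firstP⇒ X i a) (firstP⇒ X j b)
  never-ends-never-p : ∀ X → (∀ i → ¬ Ends waitForP X i) → ¬ SatI (induced waitForP X) 0 eventually-p
  never-ends-never-p X never (j , _ , pj , _) with firstPAt-exists X j pj
  ... | i , first rewrite sym (ends-firstP X i) = never i first
  ends-in-p : ∀ X i → Ends waitForP X i → SatF (suc i) (induced waitForP X) 0 eventually-p
  ends-in-p X i h = i , z≤n , ≤-refl , firstPAt-holds X i (firstP⇒ X i h) , λ _ _ _ → ⋆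

pFrom : ℕ → Input 1
pFrom B k _ = ⌊ B ≤? k ⌋

pFrom-before : ∀ B k → k < B → pFrom B k zero ≢ true
pFrom-before B k k<B h with B ≤? k
... | yes B≤k = <⇒≱ k<B B≤k
... | no _    = false≢true h

pFrom-at : ∀ B → pFrom B B zero ≡ true
pFrom-at B with B ≤? B
... | yes _  = refl
... | no B≰B = ⊥-elim (B≰B ≤-refl)

-- A winning strategy bounded by B cannot end on pFrom B, since p is false
-- throughout the first B positions; but then it violates the α-strategy
-- condition, because the induced infinite trace satisfies ◇p.
no-bounded-winner : ¬ (∃[ σ ] (CWinning eventually-p eventually-p σ × Bounded σ))
no-bounded-winner (σ , ((_ , α-strategy) , wins) , B , _ , bounded) =
  α-strategy (pFrom B) never-ends (B , z≤n , pFrom-at B , λ _ _ _ → ⋆)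
  where
  never-ends : ∀ i → ¬ Ends σ (pFrom B) i
  never-ends i ends with wins (pFrom B) i ends
  ... | j , _ , j<i+1 , pj , _ = pFrom-before B j (≤-trans j<i+1 (bounded (pFrom B) i ends)) pj

theorem3 :
    ((nX nY : ℕ) (φ : Formula nX nY) →
        Realizable φ ⇔ (∃[ σ ] (Winning φ σ × Bounded σ)))
    × (∃[ nX ] ∃[ nY ] ∃[ α ] ∃[ φ ]
        (CRealizable {nX} {nY} α φ × ¬ (∃[ σ ] (CWinning α φ σ × Bounded σ))))
theorem3 =
  (λ nX nY φ → mk⇔ (Game.realizable⇒bounded φ) (λ (σ , winning , _) → σ , winning)) ,
  (1 , 0 , eventually-p , eventually-p , (waitForP , waitForP-wins) , no-bounded-winner)
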